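{- Let $\alpha,\beta$ be relatively prime positive integers and $s\ge2$ an integer. If $n$ is a positive integer with $n>\beta g_{s-1}g_{s-2}$, then $s(n)\ge s$.
   Context: For positive integers $a_1,a_2$, the $(\alpha,\beta)$-walk $w_k(a_1,a_2)$ is the sequence with $w_1=a_1$, $w_2=a_2$, $w_{k+2}=\alpha w_{k+1}+\beta w_k$ for $k\ge1$. For a positive integer $n$, $s(n;a_1,a_2)$ is the (largest) index $s$ with $w_s(a_1,a_2)=n$ ($-\infty$ if none), and $s(n)=\max_{a_1,a_2\ge1}s(n;a_1,a_2)$. The sequence $g_k$ is defined by $g_1=1$, $g_2=\alpha$, $g_{k+2}=\alpha g_{k+1}+\beta g_k$ for $k\ge1$, with the convention $g_0=0$. -}

module Defs where

open import Data.Nat using (ℕ; zero; suc; _+_; _*_; _≤_)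
open import Data.Product using (∃-syntax; _×_)
open import Relation.Binary.PropositionalEquality using (_≡_)

-- Index 0 is not part of the walk (only used as padding, set to 0; never relevant
-- since the statement only considers indices ≥ 1).
walk : (α β a₁ a₂ : ℕ) → ℕ → ℕ
walk α β a₁ a₂ zero = 0
walk α β a₁ a₂ (suc zero) = a₁
walk α β a₁ a₂ (suc (suc zero)) = a₂
walk α β a₁ a₂ (suc (suc (suc k))) =
  α * walk α β a₁ a₂ (suc (suc k)) + β * walk α β a₁ a₂ (suc k)

g : (α β : ℕ) → ℕ → ℕ
g α β zero = 0
g α β (suc zero) = 1
g α β (suc (suc k)) = α * g α β (suc k) + β * g α β k

-- s(n) ≥ s, where s(n) = max over a₁,a₂ ≥ 1 of the largest index s' with
-- w_{s'}(a₁,a₂) = n (−∞ if none).  Unfolded: some walk with a₁,a₂ ≥ 1 hits n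
-- at some index k ≥ s.
sOfAtLeast : (α β n s : ℕ) → Set
sOfAtLeast α β n s =
  ∃[ a₁ ] ∃[ a₂ ] ∃[ k ] (1 ≤ a₁ × 1 ≤ a₂ × s ≤ k × walk α β a₁ a₂ k ≡ n)

-- Every walk is a combination of two consecutive terms of g: w_{k+2} = g_{k+1} a₂ + β g_k a₁.
-- By the recurrence, g_{k+1} and β g_k are coprime, so the classical Frobenius argument
-- (choose a₁ ∈ [1, g_{k+1}] with β g_k a₁ ≡ n modulo g_{k+1}) writes every
-- n > g_{k+1} · β g_k with both coefficients positive, i.e. as the (k+2)-nd term of a walk.
module Submission where

open import Defs
open import Data.Nat
  using (ℕ; zero; suc; pred; _+_; _*_; _∸_; _%_; _≤_; _<_; z≤n; s≤s; NonZero; >-nonZero)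
open import Data.Nat.Properties
  using ( +-comm; +-suc; *-comm; *-identityʳ; *-distribʳ-∸; [m+n]∸[m+o]≡n∸o; m∸n+n≡m
        ; m>n⇒m∸n≢0; suc-pred; ≤-refl; ≤-trans; ≤-<-trans; <⇒≤; m≤m+n; *-mono-≤; *-monoʳ-≤)
open import Data.Nat.DivMod
  using ( _/_; m≡m%n+[m/n]*n; m%n<n; m%n%n≡m%n; [m+n]%n≡m%n; [m+kn]%n≡m%n
        ; %-distribˡ-+; %-distribˡ-*)
open import Data.Nat.Divisibility
  using (_∣_; divides; ∣-trans; ∣m+n∣m⇒∣n; m∣m*n; n∣m*n)
open import Data.Nat.GCD using (module Bézout)
open import Data.Nat.Coprimality using (Coprime; 1-coprimeTo; coprime-divisor; coprime-Bézout)
import Data.Nat.Coprimality as Coprimality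
open import Data.Nat.Tactic.RingSolver using (solve-∀)
open import Data.Product using (∃-syntax; _×_; _,_)
open import Relation.Binary.PropositionalEquality
open import Relation.Nullary using (contradiction)

private
  variable
    d k m n o : ℕ

coprime-∣ʳ : n ∣ o → Coprime m o → Coprime m n
coprime-∣ʳ n∣o cop (e∣m , e∣n) = cop (e∣m , ∣-trans e∣n n∣o)

coprime-*ʳ : Coprime m n → Coprime m o → Coprime m (n * o)
coprime-*ʳ {o = o} m⊥n m⊥o {e} (e∣m , e∣no) = m⊥o (e∣m , e∣o)
  where
  e∣o : e ∣ o
  e∣o = coprime-divisor (Coprimality.sym (coprime-∣ʳ e∣m (Coprimality.sym m⊥n))) e∣no

coprime-+-multiple : n ∣ k → Coprime m n → Coprime (m + k) n
coprime-+-multiple {n} {k} {m} n∣k cop {e} (e∣m+k , e∣n) =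
  cop (∣m+n∣m⇒∣n (subst (e ∣_) (+-comm m k) e∣m+k) (∣-trans e∣n n∣k) , e∣n)

g[1+k]>0 : ∀ {α} β → 1 ≤ α → ∀ k → 0 < g α β (suc k)
g[1+k]>0 β 1≤α zero    = s≤s z≤n
g[1+k]>0 β 1≤α (suc k) = ≤-trans (*-mono-≤ 1≤α (g[1+k]>0 β 1≤α k)) (m≤m+n _ _)

g[1+k]-coprime-β*g[k] : ∀ {α β} → Coprime α β → ∀ k → Coprime (g α β (suc k)) (β * g α β k)
g[1+k]-coprime-β*g[k] {α} {β} α⊥β zero = 1-coprimeTo (β * 0)
g[1+k]-coprime-β*g[k] {α} {β} α⊥β (suc k) = coprime-*ʳ g₂⊥β g₂⊥g₁
  where
  g₀ g₁ : ℕ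
  g₀ = g α β k
  g₁ = g α β (suc k)
  g₁⊥βg₀ : Coprime g₁ (β * g₀)
  g₁⊥βg₀ = g[1+k]-coprime-β*g[k] α⊥β k
  β⊥g₁ : Coprime β g₁
  β⊥g₁ = Coprimality.sym (coprime-∣ʳ (m∣m*n g₀) g₁⊥βg₀)
  g₂⊥β : Coprime (α * g₁ + β * g₀) β
  g₂⊥β = coprime-+-multiple (m∣m*n g₀) (Coprimality.sym (coprime-*ʳ (Coprimality.sym α⊥β) β⊥g₁))
  g₂⊥g₁ : Coprime (α * g₁ + β * g₀) g₁
  g₂⊥g₁ = subst (λ t → Coprime t g₁) (+-comm (β * g₀) (α * g₁))
    (coprime-+-multiple (n∣m*n α) (Coprimality.sym g₁⊥βg₀))

walk-closed-form : ∀ α β a₁ a₂ k →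
  walk α β a₁ a₂ (suc (suc k)) ≡ g α β (suc k) * a₂ + β * g α β k * a₁
walk-closed-form α β a₁ a₂ zero = base β a₁ a₂
  where
  base : ∀ β a₁ a₂ → a₂ ≡ 1 * a₂ + β * 0 * a₁
  base = solve-∀
walk-closed-form α β a₁ a₂ (suc zero) = base α β a₁ a₂
  where
  base : ∀ α β a₁ a₂ → α * a₂ + β * a₁ ≡ (α * 1 + β * 0) * a₂ + β * 1 * a₁
  base = solve-∀
walk-closed-form α β a₁ a₂ (suc (suc k))
  rewrite walk-closed-form α β a₁ a₂ (suc k) | walk-closed-form α β a₁ a₂ k =
  step α β a₁ a₂ (g α β (suc (suc k))) (g α β (suc k)) (g α β k)
  where
  step : ∀ α β a₁ a₂ g₂ g₁ g₀ →
    α * (g₂ * a₂ + β * g₁ * a₁) + β * (g₁ * a₂ + β * g₀ * a₁)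
    ≡ (α * g₂ + β * g₁) * a₂ + β * (α * g₁ + β * g₀) * a₁
  step = solve-∀

%-*-congˡ : .{{_ : NonZero d}} → ∀ o → m % d ≡ n % d → (o * m) % d ≡ (o * n) % d
%-*-congˡ {d} {m} {n} o eq = begin
  (o * m) % d             ≡⟨ %-distribˡ-* o m d ⟩
  (o % d * (m % d)) % d   ≡⟨ cong (λ t → (o % d * t) % d) eq ⟩
  (o % d * (n % d)) % d   ≡⟨ %-distribˡ-* o n d ⟨
  (o * n) % d             ∎
  where open ≡-Reasoning

%≡%⇒∣∸ : .{{_ : NonZero d}} → m % d ≡ n % d → d ∣ m ∸ n
%≡%⇒∣∸ {d} {m} {n} eq = divides (m / d ∸ n / d) (begin
  m ∸ n                                     ≡⟨ cong₂ _∸_ (m≡m%n+[m/n]*n m d) (m≡m%n+[m/n]*n n d) ⟩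
  (m % d + m / d * d) ∸ (n % d + n / d * d) ≡⟨ cong (λ t → (m % d + m / d * d) ∸ (t + n / d * d)) eq ⟨
  (m % d + m / d * d) ∸ (m % d + n / d * d) ≡⟨ [m+n]∸[m+o]≡n∸o (m % d) (m / d * d) (n / d * d) ⟩
  m / d * d ∸ n / d * d                     ≡⟨ *-distribʳ-∸ d (m / d) (n / d) ⟨
  (m / d ∸ n / d) * d                       ∎)
  where open ≡-Reasoning

-- The shift by d − 1 moves the representative of residue 0 from 0 to d.
%-representative-[1,d] : .{{_ : NonZero d}} → ∀ m → ∃[ y ] (1 ≤ y × y ≤ d × y % d ≡ m % d)
%-representative-[1,d] {d} m = suc r , s≤s z≤n , m%n<n (m + pred d) d , (begin
  suc r % d                          ≡⟨ %-distribˡ-+ 1 r d ⟩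
  (1 % d + r % d) % d                ≡⟨ cong (λ t → (1 % d + t) % d) (m%n%n≡m%n (m + pred d) d) ⟩
  (1 % d + (m + pred d) % d) % d     ≡⟨ %-distribˡ-+ 1 (m + pred d) d ⟨
  suc (m + pred d) % d               ≡⟨ cong (_% d) (trans (sym (+-suc m (pred d))) (cong (m +_) (suc-pred d))) ⟩
  (m + d) % d                        ≡⟨ [m+n]%n≡m%n m d ⟩
  m % d                              ∎)
  where
  open ≡-Reasoning
  r = (m + pred d) % d

-- Bézout gives 1 + y b = x d; then −1 ≡ y b, so (d − 1) y inverts b modulo d.
coprime⇒%-invertible : ∀ {b} .{{_ : NonZero d}} → Coprime d b → ∃[ u ] ((u * b) % d ≡ 1 % d)
coprime⇒%-invertible {suc a} {b} cop with coprime-Bézout cop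
... | Bézout.-+ x y 1+xd≡yb = y , (begin
  (y * b) % suc a            ≡⟨ cong (_% suc a) 1+xd≡yb ⟨
  (1 + x * suc a) % suc a    ≡⟨ [m+kn]%n≡m%n 1 x (suc a) ⟩
  1 % suc a                  ∎)
  where open ≡-Reasoning
... | Bézout.+- x y 1+yb≡xd = a * y , (begin
  (a * y * b) % suc a                ≡⟨ [m+kn]%n≡m%n (a * y * b) 1 (suc a) ⟨
  (a * y * b + 1 * suc a) % suc a    ≡⟨ cong (_% suc a) shift ⟩
  (1 + a * x * suc a) % suc a        ≡⟨ [m+kn]%n≡m%n 1 (a * x) (suc a) ⟩
  1 % suc a                          ∎)
  where
  open ≡-Reasoning
  expand : ∀ a y b → a * y * b + 1 * suc a ≡ 1 + a * (1 + y * b)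
  expand = solve-∀
  regroup : ∀ a x → 1 + a * (x * suc a) ≡ 1 + a * x * suc a
  regroup = solve-∀
  shift : a * y * b + 1 * suc a ≡ 1 + a * x * suc a
  shift = trans (expand a y b) (trans (cong (λ t → 1 + a * t) 1+yb≡xd) (regroup a x))

%≡%-<⇒≡+positive-multiple : .{{_ : NonZero d}} → m % d ≡ n % d → m < n →
  ∃[ x ] (1 ≤ x × n ≡ d * x + m)
%≡%-<⇒≡+positive-multiple {d} {m} {n} m≡n m<n with %≡%⇒∣∸ (sym m≡n)
... | divides zero n∸m≡0 = contradiction n∸m≡0 (m>n⇒m∸n≢0 m<n)
... | divides (suc x) n∸m≡xd = suc x , s≤s z≤n , (begin
  n                ≡⟨ m∸n+n≡m (<⇒≤ m<n) ⟨
  n ∸ m + m        ≡⟨ cong (_+ m) (trans n∸m≡xd (*-comm (suc x) d)) ⟩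
  d * suc x + m    ∎)
  where open ≡-Reasoning

positive-combination : ∀ {a b n} .{{_ : NonZero a}} → Coprime a b → a * b < n →
  ∃[ x ] ∃[ y ] (1 ≤ x × 1 ≤ y × n ≡ a * x + b * y)
positive-combination {a} {b} {n} cop ab<n =
  let u , ub≡1 = coprime⇒%-invertible cop
      y , 1≤y , y≤a , y≡nu = %-representative-[1,d] (n * u)
      x , 1≤x , n≡ax+by = %≡%-<⇒≡+positive-multiple (by≡n u y ub≡1 y≡nu) (by<n y≤a)
  in x , y , 1≤x , 1≤y , n≡ax+by
  where
  by<n : ∀ {y} → y ≤ a → b * y < n
  by<n y≤a = ≤-<-trans (*-monoʳ-≤ b y≤a) (subst (_< n) (*-comm a b) ab<n)
  by≡n : ∀ u y → (u * b) % a ≡ 1 % a → y % a ≡ (n * u) % a → (b * y) % a ≡ n % a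
  by≡n u y ub≡1 y≡nu = begin
    (b * y) % a         ≡⟨ %-*-congˡ b y≡nu ⟩
    (b * (n * u)) % a   ≡⟨ cong (_% a) (rearrange b n u) ⟩
    (n * (u * b)) % a   ≡⟨ %-*-congˡ n ub≡1 ⟩
    (n * 1) % a         ≡⟨ cong (_% a) (*-identityʳ n) ⟩
    n % a               ∎
    where
    open ≡-Reasoning
    rearrange : ∀ b n u → b * (n * u) ≡ n * (u * b)
    rearrange = solve-∀

lemma7 : (α β s n : ℕ) → 1 ≤ α → 1 ≤ β → Coprime α β → 2 ≤ s → 1 ≤ n →
         β * g α β (s ∸ 1) * g α β (s ∸ 2) < n →
         sOfAtLeast α β n s
lemma7 α β (suc (suc k)) n 1≤α _ α⊥β _ _ bound =
  let x , y , 1≤x , 1≤y , n≡g₁x+βg₀y =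
        positive-combination {{>-nonZero (g[1+k]>0 β 1≤α k)}}
          (g[1+k]-coprime-β*g[k] α⊥β k) (subst (_< n) (reassoc β g₁ g₀) bound)
  in y , x , suc (suc k) , 1≤y , 1≤x , ≤-refl ,
     trans (walk-closed-form α β y x k) (sym n≡g₁x+βg₀y)
  where
  g₁ g₀ : ℕ
  g₁ = g α β (suc k)
  g₀ = g α β k
  reassoc : ∀ β g₁ g₀ → β * g₁ * g₀ ≡ g₁ * (β * g₀)
  reassoc = solve-∀
lemma7 α β (suc zero) n _ _ _ (s≤s ()) _ _
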